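{- Let $m\in\mathbb{N}$ and $n\in\{1,2,3\}$. For any two sequences of integers $c_1,\dots,c_n$ and $d_1,\dots,d_n$, each relatively prime to $m$, \[\prod_{i=1}^n\left(x^{c_i}-1\right)\equiv\prod_{i=1}^n\left(x^{d_i}-1\right)\pmod{(x^m-1)}\] holds if and only if the sequences $c_1,\dots,c_n$ and $d_1,\dots,d_n$ are congruent modulo $m$.
   Context: Two integer sequences $c_1,\dots,c_n$ and $d_1,\dots,d_n$ are congruent modulo $m$ if there is a permutation $\sigma$ of $\{1,\dots,n\}$ such that $c_i\equiv d_{\sigma(i)}\pmod m$ for all $i$. Since each $c_i,d_i$ is a unit modulo $m$, the expressions $x^{c_i}-1$ (for possibly negative $c_i$) are interpreted in $\mathbb{Q}[x]/(x^m-1)$, where $x$ is invertible. -}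

module Defs where

open import Data.Nat as ℕ using (ℕ; NonZero)
open import Data.Nat.DivMod using (_mod_)
open import Data.Nat.Coprimality using (Coprime)
open import Data.Integer as ℤ using (ℤ; ∣_∣)
open import Data.Integer.DivMod using (_%ℕ_)
open import Data.Integer.Divisibility as ℤd using ()
open import Data.Rational as ℚ using (ℚ; 0ℚ; 1ℚ)
open import Data.Fin as Fin using (Fin; toℕ)
open import Data.Fin.Permutation using (Permutation; _⟨$⟩ʳ_)
open import Data.Bool using (if_then_else_)
open import Relation.Nullary.Decidable using (does)
open import Relation.Binary.PropositionalEquality using (_≡_)
open import Data.Product using (∃)

-- The ring ℚ[x]/(x^m - 1) (m ≥ 1), represented (canonically) as the
-- group ring ℚ[ℤ/mℤ]: an element is its vector of coefficients
-- a_0 + a_1 x + … + a_{m-1} x^{m-1}, with x^m = 1.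
QuotPoly : (m : ℕ) → Set
QuotPoly m = Fin m → ℚ

expIdx : (m : ℕ) .{{_ : NonZero m}} → ℤ → Fin m
expIdx m c = (c %ℕ m) mod m

-- x^c for c ∈ ℤ (x is invertible in ℚ[x]/(x^m-1))
xpow : (m : ℕ) .{{_ : NonZero m}} → ℤ → QuotPoly m
xpow m c k = if does (k Fin.≟ expIdx m c) then 1ℚ else 0ℚ

one : (m : ℕ) .{{_ : NonZero m}} → QuotPoly m
one m = xpow m (ℤ.+ 0)

_-Q_ : ∀ {m} → QuotPoly m → QuotPoly m → QuotPoly m
(f -Q g) k = f k ℚ.- g k

sumFin : ∀ m → (Fin m → ℚ) → ℚ
sumFin ℕ.zero f = 0ℚ
sumFin (ℕ.suc m) f = f Fin.zero ℚ.+ sumFin m (λ i → f (Fin.suc i))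

mulQ : (m : ℕ) .{{_ : NonZero m}} → QuotPoly m → QuotPoly m → QuotPoly m
mulQ m f g k = sumFin m (λ i → f i ℚ.* g (expIdx m (ℤ.+ toℕ k ℤ.- ℤ.+ toℕ i)))

xpowMinusOne : (m : ℕ) .{{_ : NonZero m}} → ℤ → QuotPoly m
xpowMinusOne m c = xpow m c -Q one m

prodXpowMinusOne : (m : ℕ) .{{_ : NonZero m}} → (n : ℕ) → (Fin n → ℤ) → QuotPoly m
prodXpowMinusOne m ℕ.zero c = one m
prodXpowMinusOne m (ℕ.suc n) c =
  mulQ m (xpowMinusOne m (c Fin.zero)) (prodXpowMinusOne m n (λ i → c (Fin.suc i)))

-- equality in ℚ[x]/(x^m-1), i.e. congruence modulo (x^m - 1)
_≈Q_ : ∀ {m} → QuotPoly m → QuotPoly m → Set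
f ≈Q g = ∀ k → f k ≡ g k

_≡_[modℤ_] : ℤ → ℤ → ℕ → Set
a ≡ b [modℤ m ] = (ℤ.+ m) ℤd.∣ (a ℤ.- b)

SeqCongruent : (m n : ℕ) → (Fin n → ℤ) → (Fin n → ℤ) → Set
SeqCongruent m n c d = ∃ λ (σ : Permutation n n) → ∀ i → c i ≡ d (σ ⟨$⟩ʳ i) [modℤ m ]

-- Identify ℚ[x]/(x^m - 1) with functions of period m on ℤ. The coefficient of x^t in
-- ∏ᵢ (x^{cᵢ} - 1) is then an integer combination of translates of the indicator χ of mℤ,
-- and congruent sequences visibly give the same product.
--
-- Conversely let m ≥ 3 (for m ≤ 2 all units are congruent). Comparing the coefficients of
-- x^{c₀} on both sides shows that c₀ ≡ dⱼ for some j when n ≤ 2. When n = 3 and no cᵢ is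
-- matched, the same comparison at x^{cᵢ} gives cᵢ ≡ d₀ + d₁ + d₂ and cᵢ ≢ cⱼ, cₖ whenever
-- cᵢ ≢ cⱼ + cₖ; as 2cₗ ≢ 0, this applies to two distinct indices, a contradiction.
-- Having found cᵢ ≡ dⱼ, cancel the factor x^{cᵢ} - 1: a difference B - B' killed by it is
-- invariant under x^{cᵢ}, hence (cᵢ being a unit) under x, hence constant, and it vanishes
-- because both B and B' have coefficient sum 0. Induction on n finishes the proof.

module Submission where

open import Algebra.Bundles using (Ring)
open import Data.Bool using (if_then_else_; true; false)
open import Data.Empty using (⊥; ⊥-elim)
open import Data.Fin as Fin using (Fin; zero; suc; toℕ)
open import Data.Fin.Patterns using (0F; 1F; 2F)
import Data.Fin.Permutation as Perm
open Perm using (Permutation; _⟨$⟩ʳ_; remove; insert; transpose; punchIn-permute)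
import Data.Fin.Properties as FinP
open FinP using (any?)
open import Data.Integer using (ℤ; +_; -[1+_]; ∣_∣)
open import Data.Integer.DivMod using (_%ℕ_; _/ℕ_; n%ℕd<d; a≡a%ℕn+[a/ℕn]*n)
open import Data.Integer.Divisibility.Signed
import Data.Integer.Properties as ℤP
open import Data.Integer.Tactic.RingSolver using (solve-∀)
open import Data.Nat as ℕ using (ℕ; zero; suc; NonZero; _<_; _≤_)
import Data.Nat.Coprimality as Coprimality
open Coprimality using (Coprime)
import Data.Nat.Divisibility as ℕ∣
open import Data.Nat.DivMod using (m<n⇒m%n≡m)
open import Data.Nat.GCD using (module Bézout)
import Data.Nat.Properties as ℕP
open import Data.Product using (_,_; _×_; ∃; ∃₂)
open import Data.Rational as ℚ using (ℚ; mkℚ)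
import Data.Rational.Properties as ℚP
open import Data.Vec.Functional using (Vector; head; tail; _∷_; removeAt)
open import Function.Base using (_∘_)
open import Function.Bundles using (_⇔_; mk⇔; Equivalence)
open import Relation.Binary.Definitions using (tri<; tri≈; tri>)
open import Relation.Nullary using (Dec; ¬_; yes; no)
open import Relation.Nullary.Decidable using (does; does-⇔; dec-true; dec-false; decidable-stable)
open import Relation.Nullary.Negation using (contradiction)

open import Defs

module FinSum {c ℓ} (R : Ring c ℓ) where

  open Ring R hiding (zero)
  open import Algebra.Properties.Semiring.Sum semiring public
    using (sum; sum-syntax; sum-cong-≋; ∑-distrib-+; sum-replicate-zero)
  open import Algebra.Properties.RingWithoutOne ringWithoutOne using ([y-z]x≈yx-zx)
  open import Algebra.Properties.AbelianGroup +-abelianGroup using (⁻¹-∙-comm)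
  open import Relation.Binary.Reasoning.Setoid setoid

  δ : ∀ {n} → Fin n → Fin n → Carrier
  δ i j = if does (i Fin.≟ j) then 1# else 0#

  ∑-zero : ∀ {n} (g : Vector Carrier n) → ∑[ i < n ] (0# * g i) ≈ 0#
  ∑-zero {n} g = trans (sum-cong-≋ (λ i → zeroˡ (g i))) (sum-replicate-zero n)

  ∑-δ : ∀ {n} (g : Vector Carrier n) j → ∑[ i < n ] (δ i j * g i) ≈ g j
  ∑-δ {suc n} g zero = begin
    1# * g zero + ∑[ i < n ] (0# * g (suc i))  ≈⟨ +-cong (*-identityˡ _) (∑-zero (λ i → g (suc i))) ⟩
    g zero + 0#                                 ≈⟨ +-identityʳ _ ⟩
    g zero                                      ∎
  ∑-δ {suc n} g (suc j) = begin
    0# * g zero + ∑[ i < n ] (δ i j * g (suc i))  ≈⟨ +-cong (zeroˡ _) (∑-δ (λ i → g (suc i)) j) ⟩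
    0# + g (suc j)                                 ≈⟨ +-identityˡ _ ⟩
    g (suc j)                                      ∎

  ∑-neg : ∀ {n} (f : Vector Carrier n) → ∑[ i < n ] (- f i) ≈ - ∑[ i < n ] f i
  ∑-neg {zero} f = sym -0#≈0#
    where open import Algebra.Properties.Ring R using (-0#≈0#)
  ∑-neg {suc n} f = trans (+-congˡ (∑-neg (λ i → f (suc i)))) (⁻¹-∙-comm _ _)

  ∑-distrib-- : ∀ {n} (f g : Vector Carrier n) →
                ∑[ i < n ] (f i - g i) ≈ ∑[ i < n ] f i - ∑[ i < n ] g i
  ∑-distrib-- f g = trans (∑-distrib-+ f (λ i → - g i)) (+-congˡ (∑-neg g))

  ∑-δ-difference : ∀ {n} (g : Vector Carrier n) j j′ →
                   ∑[ i < n ] ((δ i j - δ i j′) * g i) ≈ g j - g j′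
  ∑-δ-difference g j j′ = begin
    ∑[ i < _ ] ((δ i j - δ i j′) * g i)         ≈⟨ sum-cong-≋ (λ i → [y-z]x≈yx-zx (g i) _ _) ⟩
    ∑[ i < _ ] (δ i j * g i - δ i j′ * g i)      ≈⟨ ∑-distrib-- (λ i → δ i j * g i) (λ i → δ i j′ * g i) ⟩
    ∑[ i < _ ] (δ i j * g i) - ∑[ i < _ ] (δ i j′ * g i) ≈⟨ +-cong (∑-δ g j) (-‿cong (∑-δ g j′)) ⟩
    g j - g j′                                    ∎

-- Opened only now: inside FinSum these names denote the ring operations.
open import Data.Integer using (_+_; _-_; _*_; -_)
open import Relation.Binary.PropositionalEquality
  using (_≡_; _≢_; _≗_; refl; sym; trans; cong; cong₂; subst; module ≡-Reasoning)

fromℤ : ℤ → ℚ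
fromℤ z = z ℚ./ 1

coprime-1 : ∀ n → Coprime n 1
coprime-1 n = Coprimality.sym (Coprimality.1-coprimeTo n)

fromℤ≡mkℚ : ∀ z → fromℤ z ≡ mkℚ z 0 (coprime-1 ∣ z ∣)
fromℤ≡mkℚ (+ n)    = ℚP.normalize-coprime {n} {0} (coprime-1 n)
fromℤ≡mkℚ -[1+ n ] = cong ℚ.-_ (ℚP.normalize-coprime {suc n} {0} (coprime-1 (suc n)))

fromℤ-injective : ∀ {a b} → fromℤ a ≡ fromℤ b → a ≡ b
fromℤ-injective {a} {b} eq = cong ℚ.↥_ (trans (sym (fromℤ≡mkℚ a)) (trans eq (fromℤ≡mkℚ b)))

-- The second step holds because mkℚ a 0 _ ℚ.+ mkℚ b 0 _ unfolds to (a * + 1 + b * + 1) ℚ./ 1.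
fromℤ-homo-+ : ∀ a b → fromℤ (a + b) ≡ fromℤ a ℚ.+ fromℤ b
fromℤ-homo-+ a b = begin
  fromℤ (a + b)                       ≡⟨ cong fromℤ (cong₂ _+_ (ℤP.*-identityʳ a) (ℤP.*-identityʳ b)) ⟨
  fromℤ (a * + 1 + b * + 1)           ≡⟨ cong₂ ℚ._+_ (fromℤ≡mkℚ a) (fromℤ≡mkℚ b) ⟨
  fromℤ a ℚ.+ fromℤ b                 ∎
  where open ≡-Reasoning

fromℤ-homo‿- : ∀ a → fromℤ (- a) ≡ ℚ.- fromℤ a
fromℤ-homo‿- a = trans (fromℤ≡mkℚ (- a)) (trans (mkℚ-neg a) (cong ℚ.-_ (sym (fromℤ≡mkℚ a))))
  where
  mkℚ-neg : ∀ a → mkℚ (- a) 0 (coprime-1 ∣ - a ∣) ≡ ℚ.- mkℚ a 0 (coprime-1 ∣ a ∣)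
  mkℚ-neg (+ zero)  = refl
  mkℚ-neg (+ suc n) = refl
  mkℚ-neg -[1+ n ]  = refl

fromℤ-homo-- : ∀ a b → fromℤ (a - b) ≡ fromℤ a ℚ.- fromℤ b
fromℤ-homo-- a b = trans (fromℤ-homo-+ a (- b)) (cong (fromℤ a ℚ.+_) (fromℤ-homo‿- b))

module ℚΣ = FinSum ℚP.+-*-ring
module ℤΣ = FinSum ℤP.+-*-ring
open ℤΣ using (sum-syntax)

sumFin≡sum : ∀ n (f : Vector ℚ n) → sumFin n f ≡ ℚΣ.sum f
sumFin≡sum zero    f = refl
sumFin≡sum (suc n) f = cong (f zero ℚ.+_) (sumFin≡sum n (tail f))

∣m-n⇒∣m⇔∣n : ∀ {k u v} → k ∣ u - v → ((k ∣ u) ⇔ (k ∣ v))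
∣m-n⇒∣m⇔∣n {k} {u} {v} k∣u-v = mk⇔
  (λ k∣u → subst (k ∣_) (u-[u-v]≡v u v) (∣m∣n⇒∣m-n k∣u k∣u-v))
  (λ k∣v → subst (k ∣_) (u-v+v≡u u v) (∣m∣n⇒∣m+n k∣u-v k∣v))
  where
  u-[u-v]≡v : ∀ u v → u - (u - v) ≡ v
  u-[u-v]≡v = solve-∀
  u-v+v≡u : ∀ u v → u - v + v ≡ u
  u-v+v≡u = solve-∀

sub-exchange : ∀ {x y z w} → x - y ≡ z - w → x - z ≡ y - w
sub-exchange {x} {y} {z} {w} eq = begin
  x - z                        ≡⟨ split x y z w ⟩
  (x - y) - (z - w) + (y - w)  ≡⟨ cong (λ v → v - (z - w) + (y - w)) eq ⟩
  (z - w) - (z - w) + (y - w)  ≡⟨ cancel (z - w) (y - w) ⟩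
  y - w                        ∎
  where
  open ≡-Reasoning
  split : ∀ x y z w → x - z ≡ (x - y) - (z - w) + (y - w)
  split = solve-∀
  cancel : ∀ v u → v - v + u ≡ u
  cancel = solve-∀

sub-balance : ∀ {p n p′ n′} → + p - + n ≡ + p′ - + n′ → n′ ℕ.+ p ≡ n ℕ.+ p′
sub-balance {p} {n} {p′} {n′} eq = ℤP.+-injective (begin
  + n′ + + p                  ≡⟨ split (+ p) (+ n) (+ n′) ⟩
  (+ p - + n) + (+ n + + n′)  ≡⟨ cong (_+ (+ n + + n′)) eq ⟩
  (+ p′ - + n′) + (+ n + + n′) ≡⟨ merge (+ p′) (+ n′) (+ n) ⟩
  + n + + p′                  ∎)
  where
  open ≡-Reasoning
  split : ∀ p n n′ → n′ + p ≡ (p - n) + (n + n′)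
  split = solve-∀
  merge : ∀ p′ n′ n → (p′ - n′) + (n + n′) ≡ n + p′
  merge = solve-∀

module _ (m : ℕ) .{{_ : NonZero m}} where

  -- Residues modulo m

  toℕ-expIdx : ∀ u → toℕ (expIdx m u) ≡ u %ℕ m
  toℕ-expIdx u = trans (FinP.toℕ-fromℕ< _) (m<n⇒m%n≡m (n%ℕd<d u m))

  expIdx-congruent : ∀ u → + m ∣ + toℕ (expIdx m u) - u
  expIdx-congruent u = divides (- (u /ℕ m)) (begin
    + toℕ (expIdx m u) - u                        ≡⟨ cong₂ _-_ (cong +_ (toℕ-expIdx u)) (a≡a%ℕn+[a/ℕn]*n u m) ⟩
    + (u %ℕ m) - (+ (u %ℕ m) + (u /ℕ m) * + m)    ≡⟨ cancel (+ (u %ℕ m)) (u /ℕ m) (+ m) ⟩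
    - (u /ℕ m) * + m                              ∎)
    where
    open ≡-Reasoning
    cancel : ∀ a q k → a - (a + q * k) ≡ - q * k
    cancel = solve-∀

  m∣a-a : ∀ a → + m ∣ a - a
  m∣a-a a = divides (+ 0) (ℤP.+-inverseʳ a)

  0<d<m⇒m∤d : ∀ {d} → 0 < d → d < m → ¬ + m ∣ + d
  0<d<m⇒m∤d 0<d d<m m∣d = ℕ∣.>⇒∤ {{ℕ.>-nonZero 0<d}} d<m (∣⇒∣ᵤ m∣d)

  congruent-residues⇒≡ : ∀ {a b} → a < m → b < m → + m ∣ + a - + b → a ≡ b
  congruent-residues⇒≡ {a} {b} a<m b<m m∣a-b with ℕ.<-cmp a b
  ... | tri≈ _ a≡b _ = a≡b
  ... | tri< a<b _ _ = contradiction m∣b-a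
        (0<d<m⇒m∤d (ℕP.m<n⇒0<n∸m a<b) (ℕP.≤-<-trans (ℕP.m∸n≤m b a) b<m))
    where
    m∣b-a : + m ∣ + (b ℕ.∸ a)
    m∣b-a = subst (+ m ∣_) (trans (cong -_ (trans (ℤP.m-n≡m⊖n a b) (ℤP.⊖-< a<b))) (ℤP.neg-involutive _))
                  (∣m⇒∣-m m∣a-b)
  ... | tri> _ _ b<a = contradiction m∣a-b′
        (0<d<m⇒m∤d (ℕP.m<n⇒0<n∸m b<a) (ℕP.≤-<-trans (ℕP.m∸n≤m a b) a<m))
    where
    m∣a-b′ : + m ∣ + (a ℕ.∸ b)
    m∣a-b′ = subst (+ m ∣_) (trans (ℤP.m-n≡m⊖n a b) (ℤP.⊖-≥ (ℕP.<⇒≤ b<a))) m∣a-b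

  ≡expIdx⇔congruent : ∀ (k : Fin m) u → (k ≡ expIdx m u) ⇔ (+ m ∣ + toℕ k - u)
  ≡expIdx⇔congruent k u = mk⇔
    (λ k≡r → subst (λ j → + m ∣ + toℕ j - u) (sym k≡r) (expIdx-congruent u))
    (λ m∣k-u → FinP.toℕ-injective (congruent-residues⇒≡ (FinP.toℕ<n k) (FinP.toℕ<n (expIdx m u))
      (subst (+ m ∣_) (cancel (+ toℕ k) (+ toℕ (expIdx m u)) u) (∣m∣n⇒∣m-n m∣k-u (expIdx-congruent u)))))
    where
    cancel : ∀ a b u → (a - u) - (b - u) ≡ a - b
    cancel = solve-∀

  -- Coefficients of ∏ᵢ (x^{cᵢ} - 1)

  -- Opaque so that unification never unfolds χ.
  opaque
    χ : ℤ → ℕ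
    χ u = if does (+ m ∣? u) then 1 else 0

    χ-∣ : ∀ {u} → + m ∣ u → χ u ≡ 1
    χ-∣ {u} m∣u rewrite dec-true (+ m ∣? u) m∣u = refl

    χ-∤ : ∀ {u} → ¬ + m ∣ u → χ u ≡ 0
    χ-∤ {u} m∤u rewrite dec-false (+ m ∣? u) m∤u = refl

    χ≤1 : ∀ u → χ u ℕ.≤ 1
    χ≤1 u with does (+ m ∣? u)
    ... | true  = ℕP.≤-refl
    ... | false = ℕ.z≤n

    χ≢0⇒∣ : ∀ {u} → χ u ≢ 0 → + m ∣ u
    χ≢0⇒∣ {u} χu≢0 = decidable-stable (+ m ∣? u) (λ m∤u → χu≢0 (χ-∤ m∤u))

    χ-periodic : ∀ {u v} → + m ∣ u - v → χ u ≡ χ v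
    χ-periodic {u} {v} m∣u-v =
      cong (λ b → if b then 1 else 0) (does-⇔ (∣m-n⇒∣m⇔∣n m∣u-v) (+ m ∣? u) (+ m ∣? v))

    χ-residue : ∀ (k : Fin m) u → χ (+ toℕ k - u) ≡ (if does (k Fin.≟ expIdx m u) then 1 else 0)
    χ-residue k u = cong (λ b → if b then 1 else 0)
      (sym (does-⇔ (≡expIdx⇔congruent k u) (k Fin.≟ expIdx m u) (+ m ∣? + toℕ k - u)))

  Periodic : ∀ {a} {A : Set a} → (ℤ → A) → Set a
  Periodic f = ∀ {t t′} → + m ∣ t - t′ → f t ≡ f t′

  -- coeff n c t is the coefficient of x^t in ∏ᵢ (x^{cᵢ} - 1):
  -- multiplication by x^a - 1 maps a coefficient function g to t ↦ g (t - a) - g t.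
  coeff : ∀ n → Vector ℤ n → ℤ → ℤ
  coeff zero    c t = + χ t
  coeff (suc n) c t = coeff n (tail c) (t - head c) - coeff n (tail c) t

  coeff-periodic : ∀ n c → Periodic (coeff n c)
  coeff-periodic zero    c {t} {t′} m∣t-t′ = cong +_ (χ-periodic {t} {t′} m∣t-t′)
  coeff-periodic (suc n) c {t} {t′} m∣t-t′ = cong₂ _-_
    (coeff-periodic n (tail c) (subst (+ m ∣_) (sym (shift t t′ (head c))) m∣t-t′))
    (coeff-periodic n (tail c) m∣t-t′)
    where
    shift : ∀ t t′ a → (t - a) - (t′ - a) ≡ t - t′
    shift = solve-∀

  coeff-cong : ∀ n (c c′ : Vector ℤ n) → (∀ i → + m ∣ c i - c′ i) → coeff n c ≗ coeff n c′
  coeff-cong zero    _ _  _    t = refl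
  coeff-cong (suc n) c c′ c≡c′ t = cong₂ _-_
    (trans (coeff-cong n (tail c) (tail c′) (c≡c′ ∘ suc) (t - head c))
           (coeff-periodic n (tail c′) (subst (+ m ∣_) (sym (shift t (head c) (head c′))) (∣m⇒∣-m (c≡c′ zero)))))
    (coeff-cong n (tail c) (tail c′) (c≡c′ ∘ suc) t)
    where
    shift : ∀ t a a′ → (t - a) - (t - a′) ≡ - (a - a′)
    shift = solve-∀

  coeff-shift-residue : ∀ n c t u → coeff n c (t - + toℕ (expIdx m u)) ≡ coeff n c (t - u)
  coeff-shift-residue n c t u =
    coeff-periodic n c (subst (+ m ∣_) (sym (shift t (+ toℕ (expIdx m u)) u)) (∣m⇒∣-m (expIdx-congruent u)))
    where
    shift : ∀ t r u → (t - r) - (t - u) ≡ - (r - u)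
    shift = solve-∀

  xpow≡fromℤ-χ : ∀ u k → xpow m u k ≡ fromℤ (+ χ (+ toℕ k - u))
  xpow≡fromℤ-χ u k rewrite χ-residue k u with does (k Fin.≟ expIdx m u)
  ... | true  = refl
  ... | false = refl

  prodXpowMinusOne≡coeff : ∀ n c k → prodXpowMinusOne m n c k ≡ fromℤ (coeff n c (+ toℕ k))
  prodXpowMinusOne≡coeff zero c k =
    trans (xpow≡fromℤ-χ (+ 0) k) (cong (λ t → fromℤ (+ χ t)) (ℤP.+-identityʳ (+ toℕ k)))
  prodXpowMinusOne≡coeff (suc n) c k = begin
    sumFin m (λ i → w i ℚ.* P (expIdx m (t - + toℕ i)))  ≡⟨ sumFin≡sum m _ ⟩
    ℚΣ.sum (λ i → w i ℚ.* P (expIdx m (t - + toℕ i)))    ≡⟨ ℚΣ.sum-cong-≋ (λ i → cong (w i ℚ.*_) (P≡g i)) ⟩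
    ℚΣ.sum (λ i → w i ℚ.* g i)                           ≡⟨ ℚΣ.∑-δ-difference g (expIdx m a) (expIdx m (+ 0)) ⟩
    g (expIdx m a) ℚ.- g (expIdx m (+ 0))                ≡⟨ cong₂ ℚ._-_ (cong fromℤ g-a) (cong fromℤ g-0) ⟩
    fromℤ (coeff n c′ (t - a)) ℚ.- fromℤ (coeff n c′ t)  ≡⟨ fromℤ-homo-- (coeff n c′ (t - a)) (coeff n c′ t) ⟨
    fromℤ (coeff (suc n) c t)                            ∎
    where
    open ≡-Reasoning
    a = head c
    c′ = tail c
    t = + toℕ k
    P = prodXpowMinusOne m n c′
    w : Vector ℚ m
    w i = ℚΣ.δ i (expIdx m a) ℚ.- ℚΣ.δ i (expIdx m (+ 0))
    g : Vector ℚ m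
    g i = fromℤ (coeff n c′ (t - + toℕ i))
    P≡g : ∀ i → P (expIdx m (t - + toℕ i)) ≡ g i
    P≡g i = trans (prodXpowMinusOne≡coeff n c′ _) (cong fromℤ (coeff-periodic n c′ (expIdx-congruent (t - + toℕ i))))
    g-a : coeff n c′ (t - + toℕ (expIdx m a)) ≡ coeff n c′ (t - a)
    g-a = coeff-shift-residue n c′ t a
    g-0 : coeff n c′ (t - + toℕ (expIdx m (+ 0))) ≡ coeff n c′ t
    g-0 = trans (coeff-shift-residue n c′ t (+ 0)) (cong (coeff n c′) (ℤP.+-identityʳ t))

  ≈Q⇔coeff-≗ : ∀ n c d → (prodXpowMinusOne m n c ≈Q prodXpowMinusOne m n d) ⇔ (coeff n c ≗ coeff n d)
  ≈Q⇔coeff-≗ n c d = mk⇔ to from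
    where
    to : prodXpowMinusOne m n c ≈Q prodXpowMinusOne m n d → coeff n c ≗ coeff n d
    to c≈d t = begin
      coeff n c t                            ≡⟨ coeff-periodic n c (expIdx-congruent t) ⟨
      coeff n c (+ toℕ (expIdx m t))         ≡⟨ fromℤ-injective (trans (sym (prodXpowMinusOne≡coeff n c _))
                                                  (trans (c≈d _) (prodXpowMinusOne≡coeff n d _))) ⟩
      coeff n d (+ toℕ (expIdx m t))         ≡⟨ coeff-periodic n d (expIdx-congruent t) ⟩
      coeff n d t                            ∎
      where open ≡-Reasoning
    from : coeff n c ≗ coeff n d → prodXpowMinusOne m n c ≈Q prodXpowMinusOne m n d
    from c≗d k = trans (prodXpowMinusOne≡coeff n c k)
                       (trans (cong fromℤ (c≗d (+ toℕ k))) (sym (prodXpowMinusOne≡coeff n d k)))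

  coeff-cong-≗ : ∀ n {c c′ : Vector ℤ n} → c ≗ c′ → coeff n c ≗ coeff n c′
  coeff-cong-≗ n {c} {c′} c≗c′ = coeff-cong n c c′ (λ i → subst (λ y → + m ∣ c i - y) (c≗c′ i) (m∣a-a (c i)))

  coeff-swap : ∀ n a b (f : Vector ℤ n) → coeff (2 ℕ.+ n) (a ∷ b ∷ f) ≗ coeff (2 ℕ.+ n) (b ∷ a ∷ f)
  coeff-swap n a b f t = begin
    (g ((t - a) - b) - g (t - a)) - (g (t - b) - g t) ≡⟨ cong (λ s → (g s - g (t - a)) - (g (t - b) - g t)) (swap t a b) ⟩
    (g ((t - b) - a) - g (t - a)) - (g (t - b) - g t) ≡⟨ exchange (g ((t - b) - a)) (g (t - a)) (g (t - b)) (g t) ⟩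
    (g ((t - b) - a) - g (t - b)) - (g (t - a) - g t) ∎
    where
    open ≡-Reasoning
    g = coeff n f
    swap : ∀ t a b → (t - a) - b ≡ (t - b) - a
    swap = solve-∀
    exchange : ∀ x y z w → (x - y) - (z - w) ≡ (x - z) - (y - w)
    exchange = solve-∀

  coeff-front : ∀ n (c : Vector ℤ (suc n)) i → coeff (suc n) c ≗ coeff (suc n) (c i ∷ removeAt c i)
  coeff-front n       c zero    t = refl
  coeff-front (suc n) c (suc i) t = begin
    coeff (2 ℕ.+ n) c t                                       ≡⟨ cong₂ _-_ (coeff-front n (tail c) i (t - head c)) (coeff-front n (tail c) i t) ⟩
    coeff (2 ℕ.+ n) (head c ∷ c (suc i) ∷ removeAt (tail c) i) t ≡⟨ coeff-swap n (head c) (c (suc i)) (removeAt (tail c) i) t ⟩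
    coeff (2 ℕ.+ n) (c (suc i) ∷ head c ∷ removeAt (tail c) i) t ≡⟨ coeff-cong-≗ (2 ℕ.+ n) reassemble t ⟩
    coeff (2 ℕ.+ n) (c (suc i) ∷ removeAt c (suc i)) t           ∎
    where
    open ≡-Reasoning
    reassemble : (c (suc i) ∷ head c ∷ removeAt (tail c) i) ≗ (c (suc i) ∷ removeAt c (suc i))
    reassemble zero          = refl
    reassemble (suc zero)    = refl
    reassemble (suc (suc k)) = refl

  coeff-permute : ∀ n c (σ : Permutation n n) → coeff n (c ∘ (σ ⟨$⟩ʳ_)) ≗ coeff n c
  coeff-permute zero    c σ t = refl
  coeff-permute (suc n) c σ t = begin
    coeff (suc n) (c ∘ (σ ⟨$⟩ʳ_)) t                    ≡⟨ cong₂ _-_ (step (t - c j)) (step t) ⟩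
    coeff (suc n) (c j ∷ removeAt c j) t               ≡⟨ coeff-front n c j t ⟨
    coeff (suc n) c t                                  ∎
    where
    open ≡-Reasoning
    j = σ ⟨$⟩ʳ zero
    τ = remove zero σ
    step : coeff n (c ∘ (σ ⟨$⟩ʳ_) ∘ suc) ≗ coeff n (removeAt c j)
    step s = trans (coeff-cong-≗ n (λ k → cong c (punchIn-permute σ zero k)) s) (coeff-permute n (removeAt c j) τ s)

  -- Cancelling a factor x^a - 1

  ∑-const : ∀ n x → ∑[ _ < n ] x ≡ + n * x
  ∑-const zero    x = refl
  ∑-const (suc n) x = trans (cong (_+_ x) (∑-const n x)) (distrib x (+ n))
    where
    distrib : ∀ x n → x + n * x ≡ (+ 1 + n) * x
    distrib = solve-∀

  ∑-χ≡1 : ∀ e → ∑[ k < m ] (+ χ (+ toℕ k - e)) ≡ + 1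
  ∑-χ≡1 e = trans (ℤΣ.sum-cong-≋ χ≡δ) (ℤΣ.∑-δ (λ _ → + 1) (expIdx m e))
    where
    χ≡δ : ∀ k → + χ (+ toℕ k - e) ≡ ℤΣ.δ k (expIdx m e) * + 1
    χ≡δ k rewrite χ-residue k e with does (k Fin.≟ expIdx m e)
    ... | true  = refl
    ... | false = refl

  ∑-coeff-suc : ∀ n c e → ∑[ k < m ] (coeff (suc n) c (+ toℕ k - e))
                          ≡ ∑[ k < m ] (coeff n (tail c) (+ toℕ k - (e + head c)))
                            - ∑[ k < m ] (coeff n (tail c) (+ toℕ k - e))
  ∑-coeff-suc n c e = trans (ℤΣ.∑-distrib-- {m} (λ k → g ((+ toℕ k - e) - head c)) (λ k → g (+ toℕ k - e)))
    (cong (_- ∑[ k < m ] g (+ toℕ k - e)) (ℤΣ.sum-cong-≋ {m} (λ k → cong g (assoc (+ toℕ k) e (head c)))))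
    where
    g = coeff n (tail c)
    assoc : ∀ t e a → (t - e) - a ≡ t - (e + a)
    assoc = solve-∀

  ∑-coeff≡0 : ∀ n c e → ∑[ k < m ] (coeff (suc n) c (+ toℕ k - e)) ≡ + 0
  ∑-coeff≡0 zero    c e = trans (∑-coeff-suc zero c e) (cong₂ _-_ (∑-χ≡1 (e + head c)) (∑-χ≡1 e))
  ∑-coeff≡0 (suc n) c e =
    trans (∑-coeff-suc (suc n) c e) (cong₂ _-_ (∑-coeff≡0 n (tail c) (e + head c)) (∑-coeff≡0 n (tail c) e))

  coprime⇒invertible : ∀ a → Coprime ∣ a ∣ m → ∃ λ u → + m ∣ u * a - + 1
  coprime⇒invertible a a⊥m = invert-sign a (invert-abs (Coprimality.coprime-Bézout a⊥m))
    where
    invert-abs : Bézout.Identity 1 ∣ a ∣ m → ∃ λ u → + m ∣ u * + ∣ a ∣ - + 1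
    invert-abs (Bézout.+- x y eq) = + x , divides (+ y) (begin
      + x * + ∣ a ∣ - + 1       ≡⟨ cong (_- + 1) (ℤP.pos-* x ∣ a ∣) ⟨
      + (x ℕ.* ∣ a ∣) - + 1     ≡⟨ cong (λ z → + z - + 1) eq ⟨
      + 1 + + (y ℕ.* m) - + 1   ≡⟨ cancel (+ (y ℕ.* m)) ⟩
      + (y ℕ.* m)               ≡⟨ ℤP.pos-* y m ⟩
      + y * + m                 ∎)
      where
      open ≡-Reasoning
      cancel : ∀ z → + 1 + z - + 1 ≡ z
      cancel = solve-∀
    invert-abs (Bézout.-+ x y eq) = - + x , divides (- + y) (begin
      - + x * + ∣ a ∣ - + 1     ≡⟨ cong (_- + 1) (ℤP.neg-distribˡ-* (+ x) (+ ∣ a ∣)) ⟨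
      - (+ x * + ∣ a ∣) - + 1   ≡⟨ cong (λ z → - z - + 1) (ℤP.pos-* x ∣ a ∣) ⟨
      - + (x ℕ.* ∣ a ∣) - + 1   ≡⟨ negate (+ (x ℕ.* ∣ a ∣)) ⟩
      - (+ 1 + + (x ℕ.* ∣ a ∣)) ≡⟨ cong (λ z → - + z) eq ⟩
      - + (y ℕ.* m)             ≡⟨ cong -_ (ℤP.pos-* y m) ⟩
      - (+ y * + m)             ≡⟨ ℤP.neg-distribˡ-* (+ y) (+ m) ⟩
      - + y * + m               ∎)
      where
      open ≡-Reasoning
      negate : ∀ z → - z - + 1 ≡ - (+ 1 + z)
      negate = solve-∀
    invert-sign : ∀ a → (∃ λ u → + m ∣ u * + ∣ a ∣ - + 1) → ∃ λ u → + m ∣ u * a - + 1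
    invert-sign (+ n)    inv       = inv
    invert-sign -[1+ n ] (u , m∣)  = - u , subst (+ m ∣_) (flip u (+ suc n)) m∣
      where
      flip : ∀ u a → u * a - + 1 ≡ - u * - a - + 1
      flip = solve-∀

  shift-invariant⇒constant : ∀ {a} {A : Set a} {f : ℤ → A} → Periodic f → ∀ {x u} → + m ∣ u * x - + 1 →
                             (∀ t → f (t - x) ≡ f t) → ∀ t → f t ≡ f (+ 0)
  shift-invariant⇒constant {f = f} f-periodic {x} {u} u*x≡1 f-invariant t = begin
    f t              ≡⟨ iterate K t ⟨
    f (t - + K * x)  ≡⟨ f-periodic (subst (+ m ∣_) (sym (split t (+ K) u x)) m∣t-Kx) ⟩
    f (+ 0)          ∎
    where
    open ≡-Reasoning
    iterate : ∀ k t → f (t - + k * x) ≡ f t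
    iterate zero    t = cong f (ℤP.+-identityʳ t)
    iterate (suc k) t = trans (cong f (peel t (+ k) x)) (trans (f-invariant (t - + k * x)) (iterate k t))
      where
      peel : ∀ t k x → t - (+ 1 + k) * x ≡ (t - k * x) - x
      peel = solve-∀
    -- K ≡ t u (mod m), so t - K x ≡ t (1 - u x) ≡ 0.
    K = toℕ (expIdx m (t * u))
    split : ∀ t K u x → t - K * x - + 0 ≡ - ((K - t * u) * x) - t * (u * x - + 1)
    split = solve-∀
    m∣t-Kx : + m ∣ - ((+ K - t * u) * x) - t * (u * x - + 1)
    m∣t-Kx = ∣m∣n⇒∣m-n (∣m⇒∣-m (∣m⇒∣m*n x (expIdx-congruent (t * u)))) (∣n⇒∣m*n t u*x≡1)

  coeff-cancel : ∀ n {a a′} (b b′ : Vector ℤ n) → Coprime ∣ a ∣ m → + m ∣ a - a′ →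
                 coeff (suc n) (a ∷ b) ≗ coeff (suc n) (a′ ∷ b′) → coeff n b ≗ coeff n b′
  coeff-cancel zero    b b′ _ _ _ t = refl
  coeff-cancel (suc n) {a} {a′} b b′ a⊥m m∣a-a′ ab≗a′b′ t = ℤP.i-j≡0⇒i≡j _ _ (trans (D-constant t) D0≡0)
    where
    B B′ D : ℤ → ℤ
    B  = coeff (suc n) b
    B′ = coeff (suc n) b′
    D s = B s - B′ s
    D-periodic : Periodic D
    D-periodic m∣s-s′ = cong₂ _-_ (coeff-periodic (suc n) b m∣s-s′) (coeff-periodic (suc n) b′ m∣s-s′)
    B′-shift : ∀ s → B′ (s - a′) ≡ B′ (s - a)
    B′-shift s = coeff-periodic (suc n) b′ (subst (+ m ∣_) (sym (shift s a′ a)) m∣a-a′)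
      where
      shift : ∀ s a′ a → (s - a′) - (s - a) ≡ a - a′
      shift = solve-∀
    D-invariant : ∀ s → D (s - a) ≡ D s
    D-invariant s = sub-exchange {B (s - a)} {B s} {B′ (s - a)} (trans (ab≗a′b′ s) (cong (_- B′ s) (B′-shift s)))
    D-constant : ∀ s → D s ≡ D (+ 0)
    D-constant with coprime⇒invertible a a⊥m
    ... | u , m∣ua-1 = shift-invariant⇒constant {f = D} D-periodic {u = u} m∣ua-1 D-invariant
    D0≡0 : D (+ 0) ≡ + 0
    D0≡0 = ℤP.*-cancelˡ-≡ (+ m) _ _ (begin
      + m * D (+ 0)                                           ≡⟨ ∑-const m (D (+ 0)) ⟨
      ∑[ k < m ] D (+ 0)                                      ≡⟨ ℤΣ.sum-cong-≋ {m} (λ k → D-constant (+ toℕ k - + 0)) ⟨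
      ∑[ k < m ] D (+ toℕ k - + 0)                            ≡⟨ ℤΣ.∑-distrib-- {m} (λ k → B (+ toℕ k - + 0)) (λ k → B′ (+ toℕ k - + 0)) ⟩
      ∑[ k < m ] B (+ toℕ k - + 0) - ∑[ k < m ] B′ (+ toℕ k - + 0) ≡⟨ cong₂ _-_ (∑-coeff≡0 n b (+ 0)) (∑-coeff≡0 n b′ (+ 0)) ⟩
      + 0                                                     ≡⟨ ℤP.*-zeroʳ (+ m) ⟨
      + m * + 0                                               ∎)
      where open ≡-Reasoning

  -- Matching exponents for n ≤ 3

  -- Expanding ∏ᵢ (x^{cᵢ} - 1), pos and neg collect the terms χ (t - Σ_{i∈S} cᵢ) with n - |S| even and odd.
  pos neg : ∀ n → Vector ℤ n → ℤ → ℕ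
  pos zero    c t = χ t
  pos (suc n) c t = neg n (tail c) t ℕ.+ pos n (tail c) (t - head c)
  neg zero    c t = 0
  neg (suc n) c t = neg n (tail c) (t - head c) ℕ.+ pos n (tail c) t

  coeff≡pos-neg : ∀ n c t → coeff n c t ≡ + pos n c t - + neg n c t
  coeff≡pos-neg zero    c t = sym (ℤP.+-identityʳ (+ χ t))
  coeff≡pos-neg (suc n) c t = begin
    coeff n c′ (t - head c) - coeff n c′ t
      ≡⟨ cong₂ _-_ (coeff≡pos-neg n c′ (t - head c)) (coeff≡pos-neg n c′ t) ⟩
    (+ pos n c′ (t - head c) - + neg n c′ (t - head c)) - (+ pos n c′ t - + neg n c′ t)
      ≡⟨ regroup (+ pos n c′ (t - head c)) (+ neg n c′ (t - head c)) (+ pos n c′ t) (+ neg n c′ t) ⟩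
    + pos (suc n) c t - + neg (suc n) c t
      ∎
    where
    open ≡-Reasoning
    c′ = tail c
    regroup : ∀ p n p′ n′ → (p - n) - (p′ - n′) ≡ (n′ + p) - (n + p′)
    regroup = solve-∀

  coeff-≗⇒balance : ∀ n c d → coeff n c ≗ coeff n d → ∀ t → neg n d t ℕ.+ pos n c t ≡ neg n c t ℕ.+ pos n d t
  coeff-≗⇒balance n c d c≗d t = sub-balance {pos n c t} {neg n c t} {pos n d t} {neg n d t}
    (trans (sym (coeff≡pos-neg n c t)) (trans (c≗d t) (coeff≡pos-neg n d t)))

  m∤b⇒m∤a-a-b : ∀ a {b} → ¬ + m ∣ b → ¬ + m ∣ (a - a) - b
  m∤b⇒m∤a-a-b a {b} m∤b m∣a-a-b = m∤b (subst (+ m ∣_) (cancel a b) (∣m∣n⇒∣m-n (m∣a-a a) m∣a-a-b))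
    where
    cancel : ∀ a b → (a - a) - ((a - a) - b) ≡ b
    cancel = solve-∀

  χ≡0⇒∤ : ∀ {u} → χ u ≡ 0 → ¬ + m ∣ u
  χ≡0⇒∤ χu≡0 m∣u = ℕP.1+n≢0 (trans (sym (χ-∣ m∣u)) χu≡0)

  match₁ : (c d : Vector ℤ 1) → coeff 1 c ≗ coeff 1 d → + m ∣ c 0F - d 0F
  match₁ c d c≗d = χ≢0⇒∣ (λ χ≡0 → ℕP.1+n≢0 (trans 1≡χ χ≡0))
    where
    a = c 0F
    1≡χ : 1 ≡ χ (a - d 0F)
    1≡χ = trans (sym (χ-∣ (m∣a-a a))) (ℕP.+-cancelˡ-≡ (χ a) _ _ (coeff-≗⇒balance 1 c d c≗d a))

  match₂ : (c d : Vector ℤ 2) → ¬ + m ∣ c 0F → ¬ + m ∣ c 1F → coeff 2 c ≗ coeff 2 d →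
           ∃ λ j → + m ∣ c 0F - d j
  match₂ c d m∤c₀ m∤c₁ c≗d with any? (λ j → + m ∣? c 0F - d j)
  ... | yes found = found
  ... | no  none  = contradiction impossible ℕP.0≢1+n
    where
    a = c 0F
    unmatched : ∀ j → χ (a - d j) ≡ 0
    unmatched j = χ-∤ (λ m∣a-dⱼ → none (j , m∣a-dⱼ))
    impossible : 0 ≡ 1 ℕ.+ χ (a - c 1F) ℕ.+ (χ a ℕ.+ χ ((a - d 0F) - d 1F))
    impossible = begin
      0                                                         ≡⟨ cong₂ ℕ._+_ (cong₂ ℕ._+_ (unmatched 0F) (unmatched 1F))
                                                                     (cong₂ ℕ._+_ (χ-∤ m∤c₀) (χ-∤ (m∤b⇒m∤a-a-b a m∤c₁))) ⟨
      neg 2 d a ℕ.+ pos 2 c a                                  ≡⟨ coeff-≗⇒balance 2 c d c≗d a ⟩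
      χ (a - a) ℕ.+ χ (a - c 1F) ℕ.+ (χ a ℕ.+ χ ((a - d 0F) - d 1F))
        ≡⟨ cong (λ v → v ℕ.+ χ (a - c 1F) ℕ.+ (χ a ℕ.+ χ ((a - d 0F) - d 1F))) (χ-∣ (m∣a-a a)) ⟩
      1 ℕ.+ χ (a - c 1F) ℕ.+ (χ a ℕ.+ χ ((a - d 0F) - d 1F))   ∎
      where open ≡-Reasoning

  unmatched-head₃ : (c d : Vector ℤ 3) → (∀ i → ¬ + m ∣ c i) → ¬ + m ∣ (c 0F - c 1F) - c 2F →
                    (∀ j → ¬ + m ∣ c 0F - d j) → coeff 3 c ≗ coeff 3 d →
                    (+ m ∣ ((c 0F - d 0F) - d 1F) - d 2F) × (¬ + m ∣ c 0F - c 1F) × (¬ + m ∣ c 0F - c 2F)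
  unmatched-head₃ c d m∤c m∤c₀-c₁-c₂ c₀-unmatched c≗d = χ≢0⇒∣ y≢0 , χ≡0⇒∤ x≡0 , χ≡0⇒∤ x′≡0
    where
    a = c 0F
    x  = χ (a - c 1F)
    x′ = χ (a - c 2F)
    w  = χ (((a - a) - c 1F) - c 2F)
    y  = χ (((a - d 0F) - d 1F) - d 2F)
    χ-unmatched : ∀ j → χ (a - d j) ≡ 0
    χ-unmatched j = χ-∤ (c₀-unmatched j)
    neg-c≡0 : neg 3 c a ≡ 0
    neg-c≡0 = cong₂ ℕ._+_ (cong₂ ℕ._+_ (χ-∤ (m∤b⇒m∤a-a-b a (m∤c 1F))) (χ-∤ (m∤b⇒m∤a-a-b a (m∤c 2F))))
                          (cong₂ ℕ._+_ (χ-∤ (m∤c 0F)) (χ-∤ m∤c₀-c₁-c₂))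
    pos-d≡y : pos 3 d a ≡ y
    pos-d≡y = cong₂ ℕ._+_ (cong₂ ℕ._+_ (χ-unmatched 1F) (χ-unmatched 2F)) (cong (ℕ._+ y) (χ-unmatched 0F))
    y≡ : y ≡ neg 3 d a ℕ.+ ((x ℕ.+ x′) ℕ.+ suc w)
    y≡ = begin
      y                                          ≡⟨ cong₂ ℕ._+_ neg-c≡0 pos-d≡y ⟨
      neg 3 c a ℕ.+ pos 3 d a                    ≡⟨ coeff-≗⇒balance 3 c d c≗d a ⟨
      neg 3 d a ℕ.+ pos 3 c a                    ≡⟨ cong (λ v → neg 3 d a ℕ.+ ((x ℕ.+ x′) ℕ.+ (v ℕ.+ w))) (χ-∣ (m∣a-a a)) ⟩
      neg 3 d a ℕ.+ ((x ℕ.+ x′) ℕ.+ suc w)      ∎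
      where open ≡-Reasoning
    x+x′+suc-w≤1 : (x ℕ.+ x′) ℕ.+ suc w ℕ.≤ 1
    x+x′+suc-w≤1 = ℕP.≤-trans (ℕP.m≤n+m _ (neg 3 d a)) (subst (ℕ._≤ 1) y≡ (χ≤1 _))
    x+x′≡0 : x ℕ.+ x′ ≡ 0
    x+x′≡0 = ℕP.m+n≡0⇒m≡0 _ (ℕP.n≤0⇒n≡0 (ℕP.≤-pred (subst (ℕ._≤ 1) (ℕP.+-suc (x ℕ.+ x′) w) x+x′+suc-w≤1)))
    x≡0 : x ≡ 0
    x≡0 = ℕP.m+n≡0⇒m≡0 x x+x′≡0
    x′≡0 : x′ ≡ 0
    x′≡0 = ℕP.m+n≡0⇒n≡0 x x+x′≡0
    y≢0 : y ≢ 0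
    y≢0 y≡0 = ℕP.m+1+n≢0 (x ℕ.+ x′) (ℕP.m+n≡0⇒n≡0 (neg 3 d a) (trans (sym y≡) y≡0))

  unmatched₃-impossible : (c d : Vector ℤ 3) → (∀ i → ¬ + m ∣ c i + c i) → coeff 3 c ≗ coeff 3 d →
                          ¬ (∀ i j → ¬ + m ∣ c i - d j)
  unmatched₃-impossible c d m∤2c c≗d unmatched =
    cases (+ m ∣? (c 0F - c 1F) - c 2F) (+ m ∣? (c 1F - c 0F) - c 2F)
    where
    m∤c : ∀ i → ¬ + m ∣ c i
    m∤c i m∣cᵢ = m∤2c i (∣m∣n⇒∣m+n m∣cᵢ m∣cᵢ)
    rotated : ∀ i → let c′ = c ∘ (transpose 0F i ⟨$⟩ʳ_) in ¬ + m ∣ (c′ 0F - c′ 1F) - c′ 2F →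
           (+ m ∣ ((c′ 0F - d 0F) - d 1F) - d 2F) × (¬ + m ∣ c′ 0F - c′ 1F) × (¬ + m ∣ c′ 0F - c′ 2F)
    rotated i ¬s = unmatched-head₃ (c ∘ (τ ⟨$⟩ʳ_)) d (m∤c ∘ (τ ⟨$⟩ʳ_)) ¬s (unmatched (τ ⟨$⟩ʳ 0F))
                                   (λ t → trans (coeff-permute 3 c τ t) (c≗d t))
      where τ = transpose 0F i
    clash : ∀ x y → + m ∣ ((x - d 0F) - d 1F) - d 2F → + m ∣ ((y - d 0F) - d 1F) - d 2F → + m ∣ x - y
    clash x y m∣x-Σ m∣y-Σ = subst (+ m ∣_) (cancel x y (d 0F) (d 1F) (d 2F)) (∣m∣n⇒∣m-n m∣x-Σ m∣y-Σ)
      where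
      cancel : ∀ x y p q r → (((x - p) - q) - r) - (((y - p) - q) - r) ≡ x - y
      cancel = solve-∀
    -- At most one of the relations cᵢ ≡ cⱼ + cₖ holds: adding two of them gives 2cₗ ≡ 0.
    both⇒double : ∀ {u v z} → + m ∣ u → + m ∣ v → u + v ≡ - z → + m ∣ z
    both⇒double {z = z} m∣u m∣v u+v≡-z =
      subst (+ m ∣_) (trans (cong -_ u+v≡-z) (ℤP.neg-involutive z)) (∣m⇒∣-m (∣m∣n⇒∣m+n m∣u m∣v))
    s₀⇒¬s₁ : + m ∣ (c 0F - c 1F) - c 2F → ¬ + m ∣ (c 1F - c 0F) - c 2F
    s₀⇒¬s₁ s₀ s₁ = m∤2c 2F (both⇒double s₀ s₁ (shape (c 0F) (c 1F) (c 2F)))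
      where
      shape : ∀ x y z → ((x - y) - z) + ((y - x) - z) ≡ - (z + z)
      shape = solve-∀
    s₀⇒¬s₂ : + m ∣ (c 0F - c 1F) - c 2F → ¬ + m ∣ (c 2F - c 1F) - c 0F
    s₀⇒¬s₂ s₀ s₂ = m∤2c 1F (both⇒double s₀ s₂ (shape (c 0F) (c 1F) (c 2F)))
      where
      shape : ∀ x y z → ((x - y) - z) + ((z - y) - x) ≡ - (y + y)
      shape = solve-∀
    s₁⇒¬s₂ : + m ∣ (c 1F - c 0F) - c 2F → ¬ + m ∣ (c 2F - c 1F) - c 0F
    s₁⇒¬s₂ s₁ s₂ = m∤2c 0F (both⇒double s₁ s₂ (shape (c 0F) (c 1F) (c 2F)))
      where
      shape : ∀ x y z → ((y - x) - z) + ((z - y) - x) ≡ - (x + x)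
      shape = solve-∀
    cases : Dec (+ m ∣ (c 0F - c 1F) - c 2F) → Dec (+ m ∣ (c 1F - c 0F) - c 2F) → ⊥
    cases (no ¬s₀) (no ¬s₁) =
      let Σ₀ , c₀≢c₁ , _ = rotated 0F ¬s₀
          Σ₁ , _ , _     = rotated 1F ¬s₁
      in c₀≢c₁ (clash (c 0F) (c 1F) Σ₀ Σ₁)
    cases (no ¬s₀) (yes s₁) =
      let Σ₀ , _ , c₀≢c₂ = rotated 0F ¬s₀
          Σ₂ , _ , _     = rotated 2F (s₁⇒¬s₂ s₁)
      in c₀≢c₂ (clash (c 0F) (c 2F) Σ₀ Σ₂)
    cases (yes s₀) _ =
      let Σ₁ , _ , c₁≢c₂ = rotated 1F (s₀⇒¬s₁ s₀)
          Σ₂ , _ , _     = rotated 2F (s₀⇒¬s₂ s₀)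
      in c₁≢c₂ (clash (c 1F) (c 2F) Σ₁ Σ₂)

  match₃ : (c d : Vector ℤ 3) → (∀ i → ¬ + m ∣ c i + c i) → coeff 3 c ≗ coeff 3 d →
           ∃₂ λ i j → + m ∣ c i - d j
  match₃ c d m∤2c c≗d with any? (λ i → any? (λ j → + m ∣? c i - d j))
  ... | yes found = found
  ... | no  none  = ⊥-elim (unmatched₃-impossible c d m∤2c c≗d (λ i j m∣ → none (i , j , m∣)))

  -- Units and the induction on n

  coprime⇒∤ : 2 ℕ.≤ m → ∀ a → Coprime ∣ a ∣ m → ¬ + m ∣ a
  coprime⇒∤ 2≤m a a⊥m m∣a = ℕP.<⇒≢ 2≤m (sym (a⊥m (∣⇒∣ᵤ m∣a , ℕ∣.∣-refl)))

  coprime⇒∤-double : 3 ℕ.≤ m → ∀ a → Coprime ∣ a ∣ m → ¬ + m ∣ a + a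
  coprime⇒∤-double 3≤m a a⊥m m∣2a = ℕP.<⇒≱ 3≤m (ℕ∣.∣⇒≤ (Coprimality.coprime-divisor (Coprimality.sym a⊥m) m∣∣a∣*2))
    where
    double : ∀ a → a + a ≡ a * + 2
    double = solve-∀
    m∣∣a∣*2 : m ℕ∣.∣ ∣ a ∣ ℕ.* 2
    m∣∣a∣*2 = subst (m ℕ∣.∣_) (trans (cong ∣_∣ (double a)) (ℤP.abs-* a (+ 2))) (∣⇒∣ᵤ m∣2a)

  coprime⇒≡1-mod≤2 : m ℕ.≤ 2 → ∀ a → Coprime ∣ a ∣ m → + m ∣ a - + 1
  coprime⇒≡1-mod≤2 m≤2 a a⊥m with toℕ (expIdx m a) | expIdx-congruent a | FinP.toℕ<n (expIdx m a)
  ... | 0           | m∣0-a | _ = subst (λ k → + k ∣ a - + 1) (sym m≡1) (divides (a - + 1) (sym (ℤP.*-identityʳ _)))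
    where
    negate : ∀ a → - (+ 0 - a) ≡ a
    negate = solve-∀
    m≡1 : m ≡ 1
    m≡1 = a⊥m (∣⇒∣ᵤ (subst (+ m ∣_) (negate a) (∣m⇒∣-m m∣0-a)) , ℕ∣.∣-refl)
  ... | 1           | m∣1-a | _ = subst (+ m ∣_) (negate a) (∣m⇒∣-m m∣1-a)
    where
    negate : ∀ a → - (+ 1 - a) ≡ a - + 1
    negate = solve-∀
  ... | suc (suc k) | _     | 2+k<m = contradiction (ℕP.≤-trans 2+k<m m≤2) λ { (ℕ.s≤s (ℕ.s≤s ())) }

  coprimes-congruent-mod≤2 : m ℕ.≤ 2 → ∀ a b → Coprime ∣ a ∣ m → Coprime ∣ b ∣ m → + m ∣ a - b
  coprimes-congruent-mod≤2 m≤2 a b a⊥m b⊥m =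
    subst (+ m ∣_) (cancel a b) (∣m∣n⇒∣m-n (coprime⇒≡1-mod≤2 m≤2 a a⊥m) (coprime⇒≡1-mod≤2 m≤2 b b⊥m))
    where
    cancel : ∀ a b → (a - + 1) - (b - + 1) ≡ a - b
    cancel = solve-∀

  congruent-insert : ∀ {n} (c d : Vector ℤ (suc n)) i j → + m ∣ c i - d j →
                     SeqCongruent m n (removeAt c i) (removeAt d j) → SeqCongruent m (suc n) c d
  congruent-insert c d i j m∣cᵢ-dⱼ (τ , c≡dτ) = insert i j τ , c≡dπ
    where
    c≡dπ : ∀ k → c k ≡ d (insert i j τ ⟨$⟩ʳ k) [modℤ m ]
    c≡dπ k with i Fin.≟ k
    ... | yes refl = ∣⇒∣ᵤ m∣cᵢ-dⱼ
    ... | no  i≢k  = subst (λ l → c l ≡ d (Fin.punchIn j (τ ⟨$⟩ʳ Fin.punchOut i≢k)) [modℤ m ])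
                       (FinP.punchIn-punchOut i≢k) (c≡dτ (Fin.punchOut i≢k))

  coeff-≗⇒match : 3 ℕ.≤ m → ∀ n → suc n ℕ.≤ 3 → (c d : Vector ℤ (suc n)) → (∀ i → Coprime ∣ c i ∣ m) →
                   coeff (suc n) c ≗ coeff (suc n) d → ∃₂ λ i j → + m ∣ c i - d j
  coeff-≗⇒match _   0 _ c d _ c≗d = 0F , 0F , match₁ c d c≗d
  coeff-≗⇒match 3≤m 1 _ c d c-units c≗d =
    0F , match₂ c d (coprime⇒∤ 2≤m (c 0F) (c-units 0F)) (coprime⇒∤ 2≤m (c 1F) (c-units 1F)) c≗d
    where
    2≤m : 2 ℕ.≤ m
    2≤m = ℕP.≤-trans (ℕP.n≤1+n 2) 3≤m
  coeff-≗⇒match 3≤m 2 _ c d c-units c≗d = match₃ c d (λ i → coprime⇒∤-double 3≤m (c i) (c-units i)) c≗d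
  coeff-≗⇒match _ (suc (suc (suc _))) (ℕ.s≤s (ℕ.s≤s (ℕ.s≤s ()))) _ _ _ _

  coeff-≗⇒congruent : 3 ℕ.≤ m → ∀ n → n ℕ.≤ 3 → (c d : Vector ℤ n) → (∀ i → Coprime ∣ c i ∣ m) →
                      coeff n c ≗ coeff n d → SeqCongruent m n c d
  coeff-≗⇒congruent _   zero    _     _ _ _ _ = Perm.id , λ ()
  coeff-≗⇒congruent 3≤m (suc n) 1+n≤3 c d c-units c≗d with coeff-≗⇒match 3≤m n 1+n≤3 c d c-units c≗d
  ... | i , j , m∣cᵢ-dⱼ = congruent-insert c d i j m∣cᵢ-dⱼ
        (coeff-≗⇒congruent 3≤m n (ℕP.≤-trans (ℕP.n≤1+n n) 1+n≤3) (removeAt c i) (removeAt d j)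
          (c-units ∘ Fin.punchIn i)
          (coeff-cancel n (removeAt c i) (removeAt d j) (c-units i) m∣cᵢ-dⱼ
            (λ t → trans (sym (coeff-front n c i t)) (trans (c≗d t) (coeff-front n d j t)))))

mainTheorem4 : (m : ℕ) .{{_ : NonZero m}} → (n : ℕ) → 1 ≤ n → n ≤ 3 →
    (c d : Fin n → ℤ) →
    (∀ i → Coprime ∣ c i ∣ m) → (∀ i → Coprime ∣ d i ∣ m) →
    (prodXpowMinusOne m n c ≈Q prodXpowMinusOne m n d) ⇔ SeqCongruent m n c d
mainTheorem4 m n _ n≤3 c d c-units d-units = mk⇔ to from
  where
  open Equivalence (≈Q⇔coeff-≗ m n c d) renaming (to to ≈Q⇒coeff-≗; from to coeff-≗⇒≈Q)
  to : prodXpowMinusOne m n c ≈Q prodXpowMinusOne m n d → SeqCongruent m n c d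
  to c≈d with m ℕ.≤? 2
  ... | yes m≤2 = Perm.id , λ i → ∣⇒∣ᵤ (coprimes-congruent-mod≤2 m m≤2 (c i) (d i) (c-units i) (d-units i))
  ... | no  m≰2 = coeff-≗⇒congruent m (ℕP.≰⇒> m≰2) n n≤3 c d c-units (≈Q⇒coeff-≗ c≈d)
  from : SeqCongruent m n c d → prodXpowMinusOne m n c ≈Q prodXpowMinusOne m n d
  from (σ , c≡dσ) = coeff-≗⇒≈Q (λ t → trans (coeff-cong m n c (d ∘ (σ ⟨$⟩ʳ_)) c-dσ t) (coeff-permute m n d σ t))
    where
    c-dσ : ∀ i → + m ∣ c i - d (σ ⟨$⟩ʳ i)
    c-dσ i = ∣ᵤ⇒∣ (c≡dσ i)
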